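{- Let $\Gamma$ be a connected weighted graph and $D$ a divisor on $\Gamma$. The Modified Greedy Algorithm, run on input $D$ (with any choices made during the run), terminates, and it returns True if and only if $D$ is winnable.
   Context: A weighted graph $\Gamma$ is a finite connected multigraph without loops, with vertex set $V(\Gamma)$, edge set $E(\Gamma)$, and weights $w: V(\Gamma)\cup E(\Gamma)\to\mathbb{Z}_{>0}$ such that the weight of each edge divides the weights of both of its endpoints. $E(v)$ denotes the edges incident to $v$, $E(u,v)$ the edges joining $u$ and $v$, and $\mathrm{val}(v)=\sum_{e\in E(v)} w(v)/w(e)$. A divisor is a function $D:V(\Gamma)\to\mathbb{Z}$; it is effective if $D(v)\ge 0$ for all $v$. A lending move at $v$ replaces $D(u)$ by $D(u)+\sum_{e\in E(u,v)} w(v)/w(e)$ for each $u\ne v$ and $D(v)$ by $D(v)-\mathrm{val}(v)$; a borrowing move at $v$ is the inverse operation. A firing script is $\sigma:V(\Gamma)\to\mathbb{Z}$; with vertices $v_1,\dots,v_n$ and weighted Laplacian $L$ ($L_{ii}=\mathrm{val}(v_i)$, $L_{ij}=-\sum_{e\in E(v_i,v_j)}w(v_j)/w(e)$ for $i\ne j$), applying $\sigma$ to $D$ yields $D-L\sigma$. $D$ is winnable if there is a firing script $\sigma$ with $D-L\sigma$ effective. The charge of $v$ is $c(v)=\mathrm{lcm}_{u\in V(\Gamma)}w(u)/w(v)$. The Modified Greedy Algorithm on input $D$: set $m(v)=0$ for all $v$. While $D$ is not effective: if there exists a vertex $v$ with $m(v)<c(v)$, choose any vertex $v_i$ with $D(v_i)<0$,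 perform a borrowing move at $v_i$ (updating $D$), and set $m(v_i)\leftarrow m(v_i)+1$; otherwise (i.e. $m(v)\ge c(v)$ for all $v$) return False. When the loop exits because $D$ is effective, return True. -}

module Defs where

open import Data.Nat as ℕ using (ℕ; zero; suc; NonZero)
open import Data.Nat.Divisibility using (_∣_)
open import Data.Nat.DivMod using (_/_)
open import Data.Nat.LCM using (lcm)
open import Data.Integer as ℤ using (ℤ; +_; -_; _+_; _-_; _*_; _≤_; _<_)
open import Data.Fin using (Fin; _≟_)
open import Data.List using (foldr)
open import Data.List.Base using (allFin)
open import Data.Bool using (Bool; true; false; if_then_else_; _∧_; _∨_)
open import Data.Product using (Σ; ∃; _×_; _,_)
open import Data.Sum using (_⊎_)
open import Relation.Nullary using (¬_; ⌊_⌋)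
open import Relation.Binary.PropositionalEquality using (_≡_; _≢_)
open import Relation.Binary.Construct.Closure.ReflexiveTransitive using (Star)

Σℤ : {k : ℕ} → (Fin k → ℤ) → ℤ
Σℤ {zero}  f = + 0
Σℤ {suc k} f = f Fin.zero + Σℤ (λ i → f (Fin.suc i))
  where import Data.Fin as Fin

record WGraph : Set where
  field
    n      : ℕ
    m      : ℕ
    src    : Fin m → Fin n
    tgt    : Fin m → Fin n
    noLoop : ∀ e → src e ≢ tgt e
    wV     : Fin n → ℕ
    wE     : Fin m → ℕ
    wV-nz  : ∀ v → NonZero (wV v)
    wE-nz  : ∀ e → NonZero (wE e)
    wE∣src : ∀ e → wE e ∣ wV (src e)
    wE∣tgt : ∀ e → wE e ∣ wV (tgt e)

module _ (G : WGraph) where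
  open WGraph G

  Adj : Fin n → Fin n → Set
  Adj u v = ∃ λ e → (src e ≡ u × tgt e ≡ v) ⊎ (src e ≡ v × tgt e ≡ u)

  Connected : Set
  Connected = ∀ u v → Star Adj u v

  ratio : Fin n → Fin m → ℤ
  ratio v e = + (_/_ (wV v) (wE e) {{wE-nz e}})

  incident : Fin m → Fin n → Bool
  incident e v = ⌊ src e ≟ v ⌋ ∨ ⌊ tgt e ≟ v ⌋

  joins : Fin m → Fin n → Fin n → Bool
  joins e u v = (⌊ src e ≟ u ⌋ ∧ ⌊ tgt e ≟ v ⌋) ∨ (⌊ src e ≟ v ⌋ ∧ ⌊ tgt e ≟ u ⌋)

  val : Fin n → ℤ
  val v = Σℤ (λ e → if incident e v then ratio v e else + 0)

  edgeSum : Fin n → Fin n → ℤ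
  edgeSum u v = Σℤ (λ e → if joins e u v then ratio v e else + 0)

  Lap : Fin n → Fin n → ℤ
  Lap i j = if ⌊ i ≟ j ⌋ then val i else - edgeSum i j

  Divisor : Set
  Divisor = Fin n → ℤ

  Effective : Divisor → Set
  Effective D = ∀ v → + 0 ≤ D v

  lend : Fin n → Divisor → Divisor
  lend v D u = if ⌊ u ≟ v ⌋ then D v - val v else D u + edgeSum u v

  borrow : Fin n → Divisor → Divisor
  borrow v D u = if ⌊ u ≟ v ⌋ then D v + val v else D u - edgeSum u v

  applyScript : (Fin n → ℤ) → Divisor → Divisor
  applyScript σ D i = D i - Σℤ (λ j → Lap i j * σ j)

  Winnable : Divisor → Set
  Winnable D = ∃ λ (σ : Fin n → ℤ) → Effective (applyScript σ D)

  lcmW : ℕ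
  lcmW = foldr lcm 1 (Data.List.map wV (allFin n))
    where import Data.List

  charge : Fin n → ℕ
  charge v = _/_ lcmW (wV v) {{wV-nz v}}

  State : Set
  State = Divisor × (Fin n → ℕ)

  incr : Fin n → (Fin n → ℕ) → (Fin n → ℕ)
  incr v mm u = if ⌊ u ≟ v ⌋ then suc (mm u) else mm u

  -- Next s' s : one iteration of the loop takes state s to state s'
  data Next : State → State → Set where
    step : ∀ {D mm} vi →
           ¬ Effective D →
           (∃ λ v → mm v ℕ.< charge v) →
           D vi < + 0 →
           Next (borrow vi D , incr vi mm) (D , mm)

  data Run : State → Bool → Set where
    retTrue  : ∀ {D mm} → Effective D → Run (D , mm) true
    retFalse : ∀ {D mm} → ¬ Effective D → (∀ v → charge v ℕ.≤ mm v) →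
               Run (D , mm) false
    continue : ∀ {s s' r} → Next s' s → Run s' r → Run s r

  initState : Divisor → State
  initState D = D , (λ _ → 0)

-- Let c be the charge vector. Every edge e at v contributes lcm/w(e) both to val(v)·c(v) and to
-- Σ_{j≠v} |L(v,j)|·c(j), so L c = 0; the off-diagonal entries of L are ≤ 0, and < 0 between
-- adjacent vertices. After borrowing m(v) times at each v the current divisor is D₀ + L m. The whole
-- argument rests on a discrete maximum principle: if m ≤ ρ pointwise, D₀ + L ρ ≥ 0 at v and the
-- current divisor is negative at v, then m(v) < ρ(v), so borrowing at v preserves m ≤ ρ.
-- If D₀ is winnable, shifting a winning script by a multiple of c gives ρ ≥ 0 with ρ(q) < c(q) for
-- some q; then m(q) < c(q) forever and the algorithm cannot return False, while a return of True
-- exhibits the winning script −m. For termination, connectivity yields for each p some ρₚ ≥ 0 with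
-- ρₚ(p) ≥ c(p) and D₀ + L ρₚ ≥ 0 off p (add multiples of c restricted to a shrinking set U ∌ p, one
-- boundary vertex at a time); while m(p) < c(p) the same principle keeps m ≤ ρₚ, so Σ m is bounded
-- and strictly increasing.

module Submission where

open import Defs
import Algebra.Properties.Semiring.Sum as SemiringSum
open import Data.Bool using (Bool; true; false; if_then_else_; _∨_; _∧_)
open import Data.Bool.Properties using (∨-zeroʳ; ∨-identityʳ; ∧-zeroʳ; ∧-identityʳ)
open import Data.Empty using (⊥)
open import Data.Fin using (Fin; _≟_; punchIn) renaming (zero to fzero; suc to fsuc)
open import Data.Fin.Properties using (punchInᵢ≢i; ¬∀⟶∃¬; all?)
open import Data.Fin.Subset using (Subset; _∈_; _∉_; _─_; _⊂_; ⁅_⁆; ∁)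
open import Data.Fin.Subset.Properties
  using (_∈?_; nonempty?; p─q⊆p; x∈p∧x≢y⇒x∈p-y; x∈p⇒p-x⊂p; x∈⁅x⁆; x∈p⇒x∉∁p; x∉p⇒x∈∁p; x≢y⇒x∉⁅y⁆)
open import Data.Fin.Subset.Induction using (⊂-wellFounded)
open import Data.Integer
  using (ℤ; +_; -_; _+_; _-_; _*_; _⊔_; _≤_; _<_; +≤+; +<+; ∣_∣; nonNegative; nonPositive)
open import Data.Integer.DivMod using (_/ℕ_; _%ℕ_; a≡a%ℕn+[a/ℕn]*n; n%ℕd<d)
open import Data.Integer.Properties hiding (_≟_)
open import Data.Integer.Tactic.RingSolver using (solve-∀)
open import Algebra.Properties.Ring +-*-ring using ([y-z]x≈yx-zx; x[y-z]≈xy-xz)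
open import Algebra.Properties.CommutativeSemigroup *-commutativeSemigroup using (x∙yz≈y∙xz)
open import Data.List using ([]; _∷_; foldr; map; allFin)
open import Data.List.Extrema ≤-totalOrder using (argmin; f[argmin]≤f[xs])
open import Data.List.Membership.Propositional using () renaming (_∈_ to _∈ˡ_)
open import Data.List.Membership.Propositional.Properties using (∈-map⁺; ∈-allFin)
open import Data.List.Relation.Unary.All using (All; []; _∷_)
import Data.List.Relation.Unary.All as All
import Data.List.Relation.Unary.All.Properties as All
open import Data.List.Relation.Unary.Any using (here; there)
open import Data.Nat as ℕ using (ℕ; zero; suc; NonZero; z≤n; s≤s)
import Data.Nat.Induction as ℕ
import Data.Nat.Properties as ℕP
open import Data.Nat.Divisibility using (_∣_; ∣-trans; ∣⇒≤)
open import Data.Nat.DivMod using (_/_; *-/-assoc; /-congˡ; m/n*n≡m; m≥n⇒m/n>0)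
open import Data.Nat.GCD using (gcd)
open import Data.Nat.LCM using (lcm; gcd*lcm; m∣lcm[m,n]; n∣lcm[m,n])
open import Data.Product using (∃; ∃₂; _×_; _,_; proj₁; proj₂)
open import Data.Sum using (_⊎_; inj₁; inj₂)
open import Function.Base using (_∘_)
open import Function.Bundles using (_⇔_; mk⇔)
open import Induction.WellFounded using (Acc; acc)
open import Relation.Binary.Construct.Closure.ReflexiveTransitive using (Star; ε; _◅_)
open import Relation.Binary.PropositionalEquality
open import Relation.Nullary using (¬_; Dec; ⌊_⌋; yes; no; contradiction)
open import Relation.Nullary.Decidable using (dec-no)
open import Relation.Unary using (Decidable)

open SemiringSum +-*-semiring
  using (sum; sum-cong-≗; sum-remove; sum-replicate-zero; ∑-distrib-+; ∑-comm; *-distribˡ-sum; *-distribʳ-sum)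

Σℤ≡sum : ∀ {k} (f : Fin k → ℤ) → Σℤ f ≡ sum f
Σℤ≡sum {zero}  f = refl
Σℤ≡sum {suc k} f = cong (_+_ (f fzero)) (Σℤ≡sum (f ∘ fsuc))

neg-distrib-sum : ∀ {k} (f : Fin k → ℤ) → - sum f ≡ sum (-_ ∘ f)
neg-distrib-sum {zero}  f = refl
neg-distrib-sum {suc k} f = trans (neg-distrib-+ (f fzero) _) (cong (_+_ (- f fzero)) (neg-distrib-sum (f ∘ fsuc)))

sum-distrib-- : ∀ {k} (f g : Fin k → ℤ) → sum (λ i → f i - g i) ≡ sum f - sum g
sum-distrib-- f g = trans (∑-distrib-+ f (-_ ∘ g)) (cong (_+_ (sum f)) (sym (neg-distrib-sum g)))

sum-mono-≤ : ∀ {k} {f g : Fin k → ℤ} → (∀ i → f i ≤ g i) → sum f ≤ sum g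
sum-mono-≤ {zero}  f≤g = ≤-refl
sum-mono-≤ {suc k} f≤g = +-mono-≤ (f≤g fzero) (sum-mono-≤ (f≤g ∘ fsuc))

sum-nonNeg : ∀ {k} {f : Fin k → ℤ} → (∀ i → + 0 ≤ f i) → + 0 ≤ sum f
sum-nonNeg {k} {f} 0≤f = subst (_≤ sum f) (sum-replicate-zero k) (sum-mono-≤ 0≤f)

term≤sum : ∀ {k} {f : Fin k → ℤ} → (∀ i → + 0 ≤ f i) → ∀ i → f i ≤ sum f
term≤sum {suc k} {f} 0≤f i = subst (f i ≤_) (sym (sum-remove {i = i} f)) (i≤i+j (f i) _ {{nonNegative (sum-nonNeg (0≤f ∘ punchIn i))}})

sum-select : ∀ {k} (f : Fin k → ℤ) i → sum (λ j → if ⌊ i ≟ j ⌋ then f j else + 0) ≡ f i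
sum-select {suc k} f i = begin
  sum g                               ≡⟨ sum-remove {i = i} g ⟩
  g i + sum (g ∘ punchIn i)           ≡⟨ cong₂ _+_ selected (trans (sum-cong-≗ zero-off-i) (sum-replicate-zero k)) ⟩
  f i + + 0                           ≡⟨ +-identityʳ (f i) ⟩
  f i                                 ∎
  where
  open ≡-Reasoning
  g : Fin (suc k) → ℤ
  g j = if ⌊ i ≟ j ⌋ then f j else + 0
  selected : g i ≡ f i
  selected with i ≟ i
  ... | yes _ = refl
  ... | no i≢i = contradiction refl i≢i
  zero-off-i : ∀ j → g (punchIn i j) ≡ + 0
  zero-off-i j with i ≟ punchIn i j
  ... | yes eq = contradiction (sym eq) (punchInᵢ≢i i j)
  ... | no _ = refl

infix 4 _≤̇_
_≤̇_ : ∀ {k} → (Fin k → ℤ) → (Fin k → ℤ) → Set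
x ≤̇ y = ∀ j → x j ≤ y j

*-preserves-0≤ : ∀ {i j} → + 0 ≤ i → + 0 ≤ j → + 0 ≤ i * j
*-preserves-0≤ (+≤+ {n = a} _) (+≤+ {n = b} _) = subst (+ 0 ≤_) (pos-* a b) (+≤+ z≤n)

*-preserves-1≤ : ∀ {i j} → + 1 ≤ i → + 1 ≤ j → + 1 ≤ i * j
*-preserves-1≤ (+≤+ {n = suc a} _) (+≤+ {n = suc b} _) = subst (+ 1 ≤_) (pos-* (suc a) (suc b)) (+≤+ (s≤s z≤n))

reduce-by-multiple : ∀ {k} (τ : Fin k → ℤ) (d : Fin k → ℕ) → (∀ v → NonZero (d v)) → Fin k →
  ∃ λ t → (∀ v → + 0 ≤ τ v - t * + d v) × ∃ λ q → τ q - t * + d q < + d q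
reduce-by-multiple {k} τ d d≢0 q₀ = t , reduced-nonNeg , q , reduced-small
  where
  quot : Fin k → ℤ
  quot v = (τ v /ℕ d v) {{d≢0 v}}
  rem : Fin k → ℕ
  rem v = (τ v %ℕ d v) {{d≢0 v}}
  q : Fin k
  q = argmin quot q₀ (allFin k)
  t : ℤ
  t = quot q
  reduced≡ : ∀ v → τ v - t * + d v ≡ + rem v + (quot v - t) * + d v
  reduced≡ v = trans (cong (λ x → x - t * + d v) (a≡a%ℕn+[a/ℕn]*n (τ v) (d v) {{d≢0 v}})) (regroup (+ rem v) (quot v) t (+ d v))
    where
    regroup : ∀ r a b e → r + a * e - b * e ≡ r + (a - b) * e
    regroup = solve-∀
  reduced-nonNeg : ∀ v → + 0 ≤ τ v - t * + d v
  reduced-nonNeg v = subst (+ 0 ≤_) (sym (reduced≡ v))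
    (+-mono-≤ (+≤+ z≤n) (*-preserves-0≤ (i≤j⇒0≤j-i (All.lookup (f[argmin]≤f[xs] {f = quot} q₀ (allFin k)) (∈-allFin v))) (+≤+ z≤n)))
  reduced-small : τ q - t * + d q < + d q
  reduced-small = subst (_< + d q) (sym (trans (reduced≡ q) (cong (λ x → + rem q + x * + d q) (+-inverseʳ t))))
    (subst (_< + d q) (sym (+-identityʳ (+ rem q))) (+<+ (n%ℕd<d (τ q) (d q) {{d≢0 q}})))

m/n*[o/m]≡o/n : ∀ {m n o} .{{_ : NonZero m}} .{{_ : NonZero n}} → n ∣ m → m ∣ o → (m / n) ℕ.* (o / m) ≡ o / n
m/n*[o/m]≡o/n {m} {n} {o} n∣m m∣o = begin
  (m / n) ℕ.* (o / m)   ≡⟨ ℕP.*-comm (m / n) (o / m) ⟩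
  (o / m) ℕ.* (m / n)   ≡⟨ *-/-assoc (o / m) n∣m ⟨
  (o / m) ℕ.* m / n     ≡⟨ /-congˡ (m/n*n≡m m∣o) ⟩
  o / n                 ∎
  where open ≡-Reasoning

lcm-nonZero : ∀ m n .{{_ : NonZero m}} .{{_ : NonZero n}} → NonZero (lcm m n)
lcm-nonZero m n = ℕP.m*n≢0⇒n≢0 (gcd m n) {{subst NonZero (sym (gcd*lcm m n)) (ℕP.m*n≢0 m n)}}

∈⇒∣foldr-lcm : ∀ {x xs} → x ∈ˡ xs → x ∣ foldr lcm 1 xs
∈⇒∣foldr-lcm {xs = y ∷ xs} (here refl) = m∣lcm[m,n] y _
∈⇒∣foldr-lcm {xs = y ∷ xs} (there x∈xs) = ∣-trans (∈⇒∣foldr-lcm x∈xs) (n∣lcm[m,n] y _)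

foldr-lcm-nonZero : ∀ {xs} → All NonZero xs → NonZero (foldr lcm 1 xs)
foldr-lcm-nonZero [] = _
foldr-lcm-nonZero {x ∷ xs} (x≢0 ∷ xs≢0) = lcm-nonZero x _ {{x≢0}} {{foldr-lcm-nonZero xs≢0}}

module _ {A : Set} {R : A → A → Set} {P : A → Set} (P? : Decidable P) where

  Star-crossing : ∀ {a b} → Star R a b → P a → ¬ P b → ∃₂ λ x y → P x × ¬ P y × R x y
  Star-crossing ε Pa ¬Pb = contradiction Pa ¬Pb
  Star-crossing {a} (_◅_ {j = a′} aRa′ path) Pa ¬Pb with P? a′
  ... | yes Pa′ = Star-crossing path Pa′ ¬Pb
  ... | no ¬Pa′ = a , a′ , Pa , ¬Pa′ , aRa′

module _ {A : Set} {_≺_ : A → A → Set} (P : A → Set) (μ : A → ℤ) (b : ℤ)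
         (increases : ∀ {x y} → y ≺ x → P x → P y × μ x < μ y × μ y ≤ b) where

  bounded-increase⇒Acc : ∀ {x} → P x → Acc _≺_ x
  bounded-increase⇒Acc Px = go Px (ℕ.<-wellFounded _)
    where
    gap-shrinks : ∀ {i j} → i < j → j ≤ b → ∣ b - j ∣ ℕ.< ∣ b - i ∣
    gap-shrinks {i} {j} i<j j≤b = nonNeg-< (i≤j⇒0≤j-i j≤b) (+-monoʳ-< b (neg-mono-< i<j))
      where
      nonNeg-< : ∀ {k l} → + 0 ≤ k → k < l → ∣ k ∣ ℕ.< ∣ l ∣
      nonNeg-< (+≤+ _) (+<+ k<l) = k<l

    go : ∀ {x} → P x → Acc ℕ._<_ ∣ b - μ x ∣ → Acc _≺_ x
    go Px (acc rec) = acc λ y≺x → let Py , μx<μy , μy≤b = increases y≺x Px in go Py (rec (gap-shrinks μx<μy μy≤b))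

module Laplacian (G : WGraph) where
  open WGraph G

  wV∣lcmW : ∀ v → wV v ∣ lcmW G
  wV∣lcmW v = ∈⇒∣foldr-lcm (∈-map⁺ wV (∈-allFin v))

  instance
    lcmW-nonZero : NonZero (lcmW G)
    lcmW-nonZero = foldr-lcm-nonZero {map wV (allFin n)} (All.map⁺ (All.tabulate λ {v} _ → wV-nz v))

  charge-pos : ∀ v → 0 ℕ.< charge G v
  charge-pos v = m≥n⇒m/n>0 {{wV-nz v}} (∣⇒≤ (wV∣lcmW v))

  ratio-pos : ∀ v e → wE e ∣ wV v → + 1 ≤ ratio G v e
  ratio-pos v e wE∣wV = +≤+ (m≥n⇒m/n>0 {{wE-nz e}} (∣⇒≤ {{wV-nz v}} wE∣wV))

  c : Fin n → ℤ
  c v = + charge G v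

  lcm/wE : Fin m → ℤ
  lcm/wE e = + (_/_ (lcmW G) (wE e) {{wE-nz e}})

  ratio*charge : ∀ v e → wE e ∣ wV v → ratio G v e * c v ≡ lcm/wE e
  ratio*charge v e wE∣wV = trans (sym (pos-* (_/_ (wV v) (wE e) {{wE-nz e}}) (charge G v))) (cong +_ (m/n*[o/m]≡o/n {{wV-nz v}} {{wE-nz e}} wE∣wV (wV∣lcmW v)))

  incident⇒wE∣wV : ∀ e v → incident G e v ≡ true → wE e ∣ wV v
  incident⇒wE∣wV e v h with src e ≟ v | tgt e ≟ v
  incident⇒wE∣wV e v h  | yes refl | _        = wE∣src e
  incident⇒wE∣wV e v h  | no _     | yes refl = wE∣tgt e
  incident⇒wE∣wV e v () | no _     | no _

  joins⇒ends : ∀ e u v → joins G e u v ≡ true → (src e ≡ u × tgt e ≡ v) ⊎ (src e ≡ v × tgt e ≡ u)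
  joins⇒ends e u v h with src e ≟ u | tgt e ≟ v | src e ≟ v | tgt e ≟ u
  joins⇒ends e u v h  | yes p | yes q | _     | _     = inj₁ (p , q)
  joins⇒ends e u v h  | _     | _     | yes p | yes q = inj₂ (p , q)
  joins⇒ends e u v () | yes _ | no _  | no _  | _
  joins⇒ends e u v () | yes _ | no _  | yes _ | no _
  joins⇒ends e u v () | no _  | _     | no _  | _
  joins⇒ends e u v () | no _  | _     | yes _ | no _

  ends⇒joins : ∀ e u v → (src e ≡ u × tgt e ≡ v) ⊎ (src e ≡ v × tgt e ≡ u) → joins G e u v ≡ true
  ends⇒joins e u v (inj₁ (p , q))
    rewrite ≡-≟-identity _≟_ p | ≡-≟-identity _≟_ q = refl
  ends⇒joins e u v (inj₂ (p , q))
    rewrite ≡-≟-identity _≟_ p | ≡-≟-identity _≟_ q = ∨-zeroʳ _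

  joins⇒wE∣wV : ∀ e u v → joins G e u v ≡ true → wE e ∣ wV v
  joins⇒wE∣wV e u v h with joins⇒ends e u v h
  ... | inj₁ (_ , refl) = wE∣tgt e
  ... | inj₂ (refl , _) = wE∣src e

  joins-irrefl : ∀ e v → joins G e v v ≡ false
  joins-irrefl e v with src e ≟ v | tgt e ≟ v
  ... | yes p | yes q = contradiction (trans p (sym q)) (noLoop e)
  ... | yes _ | no _  = refl
  ... | no _  | yes _ = refl
  ... | no _  | no _  = refl

  edgeTerm : Fin n → Fin n → Fin m → ℤ
  edgeTerm u v e = if joins G e u v then ratio G v e else + 0

  edgeSum-irrefl : ∀ v → edgeSum G v v ≡ + 0
  edgeSum-irrefl v = begin
    Σℤ (edgeTerm v v)       ≡⟨ Σℤ≡sum (edgeTerm v v) ⟩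
    sum (edgeTerm v v)      ≡⟨ sum-cong-≗ (λ e → cong (if_then ratio G v e else + 0) (joins-irrefl e v)) ⟩
    sum {m} (λ _ → + 0)     ≡⟨ sum-replicate-zero m ⟩
    + 0                     ∎
    where open ≡-Reasoning

  Lap≡diag-edgeSum : ∀ v j → Lap G v j ≡ (if ⌊ v ≟ j ⌋ then val G v else + 0) - edgeSum G v j
  Lap≡diag-edgeSum v j with v ≟ j
  ... | yes refl = sym (trans (cong (_-_ (val G v)) (edgeSum-irrefl v)) (+-identityʳ (val G v)))
  ... | no _     = sym (+-identityˡ _)

  sum-joins : ∀ e v (a : ℤ) → sum (λ j → if joins G e v j then a else + 0) ≡ (if incident G e v then a else + 0)
  sum-joins e v a with src e ≟ v | tgt e ≟ v
  ... | yes refl | yes q = contradiction (sym q) (noLoop e)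
  ... | yes refl | no _  = trans (sum-cong-≗ λ j → cong (if_then a else + 0) (trans (cong (⌊ tgt e ≟ j ⌋ ∨_) (∧-zeroʳ ⌊ src e ≟ j ⌋)) (∨-identityʳ _))) (sum-select (λ _ → a) (tgt e))
  ... | no _     | yes refl = trans (sum-cong-≗ λ j → cong (if_then a else + 0) (∧-identityʳ ⌊ src e ≟ j ⌋)) (sum-select (λ _ → a) (src e))
  ... | no _     | no _  = trans (sum-cong-≗ λ j → cong (if_then a else + 0) (∧-zeroʳ ⌊ src e ≟ j ⌋)) (sum-replicate-zero n)

  infix 8 L·_
  L·_ : (Fin n → ℤ) → Fin n → ℤ
  (L· x) v = sum (λ j → Lap G v j * x j)

  lcmIncidenceSum : Fin n → ℤ
  lcmIncidenceSum v = sum (λ e → if incident G e v then lcm/wE e else + 0)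

  val*charge : ∀ v → val G v * c v ≡ lcmIncidenceSum v
  val*charge v = begin
    val G v * c v                                  ≡⟨ cong (_* c v) (Σℤ≡sum terms) ⟩
    sum terms * c v                                ≡⟨ *-distribʳ-sum (c v) terms ⟩
    sum (λ e → terms e * c v)                      ≡⟨ sum-cong-≗ term*charge ⟩
    lcmIncidenceSum v                              ∎
    where
    open ≡-Reasoning
    terms : Fin m → ℤ
    terms e = if incident G e v then ratio G v e else + 0
    term*charge : ∀ e → terms e * c v ≡ (if incident G e v then lcm/wE e else + 0)
    term*charge e with incident G e v in h
    ... | true  = ratio*charge v e (incident⇒wE∣wV e v h)
    ... | false = refl

  edgeSum*charge : ∀ v → sum (λ j → edgeSum G v j * c j) ≡ lcmIncidenceSum v
  edgeSum*charge v = begin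
    sum (λ j → edgeSum G v j * c j)                    ≡⟨ sum-cong-≗ (λ j → cong (_* c j) (Σℤ≡sum (edgeTerm v j))) ⟩
    sum (λ j → sum (edgeTerm v j) * c j)               ≡⟨ sum-cong-≗ (λ j → *-distribʳ-sum (c j) (edgeTerm v j)) ⟩
    sum (λ j → sum (λ e → edgeTerm v j e * c j))       ≡⟨ sum-cong-≗ (λ j → sum-cong-≗ (term*charge j)) ⟩
    sum (λ j → sum (λ e → lcmTerm j e))                ≡⟨ ∑-comm lcmTerm ⟩
    sum (λ e → sum (λ j → lcmTerm j e))                ≡⟨ sum-cong-≗ (λ e → sum-joins e v (lcm/wE e)) ⟩
    lcmIncidenceSum v                                  ∎
    where
    open ≡-Reasoning
    lcmTerm : Fin n → Fin m → ℤ
    lcmTerm j e = if joins G e v j then lcm/wE e else + 0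
    term*charge : ∀ j e → edgeTerm v j e * c j ≡ lcmTerm j e
    term*charge j e with joins G e v j in h
    ... | true  = ratio*charge j e (joins⇒wE∣wV e v j h)
    ... | false = refl

  L·charge≡0 : ∀ v → (L· c) v ≡ + 0
  L·charge≡0 v = begin
    sum (λ j → Lap G v j * c j)                                   ≡⟨ sum-cong-≗ (λ j → trans (cong (_* c j) (Lap≡diag-edgeSum v j)) ([y-z]x≈yx-zx (c j) (diag j) (edgeSum G v j))) ⟩
    sum (λ j → diag j * c j - edgeSum G v j * c j)                ≡⟨ sum-distrib-- (λ j → diag j * c j) _ ⟩
    sum (λ j → diag j * c j) - sum (λ j → edgeSum G v j * c j)    ≡⟨ cong₂ _-_ (trans (sum-cong-≗ diag*charge) (sum-select (λ j → val G v * c j) v)) (edgeSum*charge v) ⟩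
    val G v * c v - lcmIncidenceSum v                             ≡⟨ cong (_- lcmIncidenceSum v) (val*charge v) ⟩
    lcmIncidenceSum v - lcmIncidenceSum v                         ≡⟨ +-inverseʳ (lcmIncidenceSum v) ⟩
    + 0                                                           ∎
    where
    open ≡-Reasoning
    diag : Fin n → ℤ
    diag j = if ⌊ v ≟ j ⌋ then val G v else + 0
    diag*charge : ∀ j → diag j * c j ≡ (if ⌊ v ≟ j ⌋ then val G v * c j else + 0)
    diag*charge j with v ≟ j
    ... | yes _ = refl
    ... | no _  = refl

  L·-cong : ∀ {x y} → (∀ j → x j ≡ y j) → ∀ v → (L· x) v ≡ (L· y) v
  L·-cong x≗y v = sum-cong-≗ (λ j → cong (Lap G v j *_) (x≗y j))

  L·-distrib-+ : ∀ x y v → (L· (λ j → x j + y j)) v ≡ (L· x) v + (L· y) v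
  L·-distrib-+ x y v = trans (sum-cong-≗ (λ j → *-distribˡ-+ (Lap G v j) (x j) (y j))) (∑-distrib-+ (λ j → Lap G v j * x j) (λ j → Lap G v j * y j))

  L·-distrib-- : ∀ x y v → (L· (λ j → x j - y j)) v ≡ (L· x) v - (L· y) v
  L·-distrib-- x y v = trans (sum-cong-≗ (λ j → x[y-z]≈xy-xz (Lap G v j) (x j) (y j))) (sum-distrib-- (λ j → Lap G v j * x j) (λ j → Lap G v j * y j))

  L·-*ˡ : ∀ k x v → (L· (λ j → k * x j)) v ≡ k * (L· x) v
  L·-*ˡ k x v = trans (sum-cong-≗ (λ j → x∙yz≈y∙xz (Lap G v j) k (x j))) (sym (*-distribˡ-sum k (λ j → Lap G v j * x j)))

  L·-neg : ∀ x v → (L· (λ j → - x j)) v ≡ - (L· x) v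
  L·-neg x v = trans (sum-cong-≗ (λ j → sym (neg-distribʳ-* (Lap G v j) (x j)))) (sym (neg-distrib-sum (λ j → Lap G v j * x j)))

  L·-shift : ∀ x t v → (L· (λ j → x j - t * c j)) v ≡ (L· x) v
  L·-shift x t v = begin
    (L· (λ j → x j - t * c j)) v         ≡⟨ L·-distrib-- x (λ j → t * c j) v ⟩
    (L· x) v - (L· (λ j → t * c j)) v    ≡⟨ cong (_-_ ((L· x) v)) (trans (L·-*ˡ t c v) (cong (t *_) (L·charge≡0 v))) ⟩
    (L· x) v - t * + 0                   ≡⟨ cong (_-_ ((L· x) v)) (*-zeroʳ t) ⟩
    (L· x) v - + 0                       ≡⟨ +-identityʳ ((L· x) v) ⟩
    (L· x) v                             ∎
    where open ≡-Reasoning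

  edgeTerm-nonNeg : ∀ u v e → + 0 ≤ edgeTerm u v e
  edgeTerm-nonNeg u v e with joins G e u v
  ... | true  = +≤+ z≤n
  ... | false = ≤-refl

  edgeSum-nonNeg : ∀ u v → + 0 ≤ edgeSum G u v
  edgeSum-nonNeg u v = subst (+ 0 ≤_) (sym (Σℤ≡sum (edgeTerm u v))) (sum-nonNeg (edgeTerm-nonNeg u v))

  Adj⇒edgeSum-pos : ∀ {u v} → Adj G u v → + 1 ≤ edgeSum G u v
  Adj⇒edgeSum-pos {u} {v} (e , ends) = begin
    + 1                  ≤⟨ ratio-pos v e (joins⇒wE∣wV e u v joined) ⟩
    ratio G v e          ≡⟨ cong (if_then ratio G v e else + 0) joined ⟨
    edgeTerm u v e       ≤⟨ term≤sum (edgeTerm-nonNeg u v) e ⟩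
    sum (edgeTerm u v)   ≡⟨ Σℤ≡sum (edgeTerm u v) ⟨
    edgeSum G u v        ∎
    where
    open ≤-Reasoning
    joined : joins G e u v ≡ true
    joined = ends⇒joins e u v ends

  L·-antitone-at : ∀ {x y} v → x ≤̇ y → x v ≡ y v → (L· y) v ≤ (L· x) v
  L·-antitone-at {x} {y} v x≤y xv≡yv = sum-mono-≤ term
    where
    term : ∀ j → Lap G v j * y j ≤ Lap G v j * x j
    term j with v ≟ j
    ... | yes refl = ≤-reflexive (cong (val G v *_) (sym xv≡yv))
    ... | no _     = *-monoˡ-≤-nonPos (- edgeSum G v j) {{nonPositive (neg-mono-≤ (edgeSum-nonNeg v j))}} (x≤y j)

  chargeOn : Subset n → Fin n → ℤ
  chargeOn U j = if ⌊ j ∈? U ⌋ then c j else + 0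

  chargeOff : Subset n → Fin n → ℤ
  chargeOff U j = if ⌊ j ∈? U ⌋ then + 0 else c j

  chargeOn-nonNeg : ∀ U j → + 0 ≤ chargeOn U j
  chargeOn-nonNeg U j with j ∈? U
  ... | yes _ = +≤+ z≤n
  ... | no _  = ≤-refl

  chargeOn≡c-chargeOff : ∀ U j → chargeOn U j ≡ c j - chargeOff U j
  chargeOn≡c-chargeOff U j with j ∈? U
  ... | yes _ = sym (+-identityʳ (c j))
  ... | no _  = sym (+-inverseʳ (c j))

  outflow : Subset n → Fin n → Fin n → ℤ
  outflow U w j = - (Lap G w j * chargeOff U j)

  L·chargeOn≡sum-outflow : ∀ U w → (L· chargeOn U) w ≡ sum (outflow U w)
  L·chargeOn≡sum-outflow U w = begin
    (L· chargeOn U) w                            ≡⟨ L·-cong (chargeOn≡c-chargeOff U) w ⟩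
    (L· (λ j → c j - chargeOff U j)) w           ≡⟨ L·-distrib-- c (chargeOff U) w ⟩
    (L· c) w - (L· chargeOff U) w                ≡⟨ cong (_- (L· chargeOff U) w) (L·charge≡0 w) ⟩
    + 0 - (L· chargeOff U) w                     ≡⟨ +-identityˡ _ ⟩
    - (L· chargeOff U) w                         ≡⟨ neg-distrib-sum (λ j → Lap G w j * chargeOff U j) ⟩
    sum (outflow U w)                            ∎
    where open ≡-Reasoning

  edgeSum*charge≡outflow : ∀ U {w j} → w ≢ j → j ∉ U → outflow U w j ≡ edgeSum G w j * c j
  edgeSum*charge≡outflow U {w} {j} w≢j j∉U
    rewrite ≢-≟-identity _≟_ w≢j | dec-no (j ∈? U) j∉U =
    trans (cong -_ (sym (neg-distribˡ-* (edgeSum G w j) (c j)))) (neg-involutive _)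

  outflow-inside : ∀ U w {j} → j ∈ U → outflow U w j ≡ + 0
  outflow-inside U w {j} j∈U with j ∈? U
  ... | yes _   = cong -_ (*-zeroʳ (Lap G w j))
  ... | no j∉U = contradiction j∈U j∉U

  outflow-nonNeg : ∀ {U w} → w ∈ U → ∀ j → + 0 ≤ outflow U w j
  outflow-nonNeg {U} {w} w∈U j = by-membership (j ∈? U)
    where
    by-membership : Dec (j ∈ U) → + 0 ≤ outflow U w j
    by-membership (yes j∈U) = ≤-reflexive (sym (outflow-inside U w j∈U))
    by-membership (no j∉U)  = subst (+ 0 ≤_) (sym (edgeSum*charge≡outflow U (λ { refl → j∉U w∈U }) j∉U))
                                (*-preserves-0≤ (edgeSum-nonNeg w j) (+≤+ z≤n))

  L·chargeOn-nonNeg : ∀ {U w} → w ∈ U → + 0 ≤ (L· chargeOn U) w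
  L·chargeOn-nonNeg {U} {w} w∈U = subst (+ 0 ≤_) (sym (L·chargeOn≡sum-outflow U w)) (sum-nonNeg (outflow-nonNeg w∈U))

  L·chargeOn-pos : ∀ {U w y} → w ∈ U → y ∉ U → Adj G w y → + 1 ≤ (L· chargeOn U) w
  L·chargeOn-pos {U} {w} {y} w∈U y∉U w~y = begin
    + 1                      ≤⟨ *-preserves-1≤ (Adj⇒edgeSum-pos w~y) (+≤+ (charge-pos y)) ⟩
    edgeSum G w y * c y      ≡⟨ edgeSum*charge≡outflow U (λ { refl → y∉U w∈U }) y∉U ⟨
    outflow U w y            ≤⟨ term≤sum (outflow-nonNeg w∈U) y ⟩
    sum (outflow U w)        ≡⟨ L·chargeOn≡sum-outflow U w ⟨
    (L· chargeOn U) w        ∎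
    where open ≤-Reasoning

module Potentials (G : WGraph) (connected : Connected G) where
  open WGraph G
  open Laplacian G

  Potential : (Fin n → ℤ) → Subset n → Set
  Potential b U = ∃ λ z → (∀ j → + 0 ≤ z j) × (∀ {w} → w ∈ U → b w ≤ (L· z) w)

  extend : ∀ {b U x y} → x ∈ U → y ∉ U → Adj G x y → Potential b (U ─ ⁅ x ⁆) → Potential b U
  extend {b} {U} {x} x∈U y∉U x~y (z′ , z′≥0 , z′≥b) = z , z≥0 , z≥b
    where
    -- (L· chargeOn U) x ≥ 1, so this weight lifts x to b x without lowering the rest of U.
    K : ℤ
    K = (b x - (L· z′) x) ⊔ + 0

    z : Fin n → ℤ
    z j = z′ j + K * chargeOn U j

    L·z : ∀ w → (L· z) w ≡ (L· z′) w + K * (L· chargeOn U) w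
    L·z w = trans (L·-distrib-+ z′ (λ j → K * chargeOn U j) w) (cong (_+_ ((L· z′) w)) (L·-*ˡ K (chargeOn U) w))

    K≥0 : + 0 ≤ K
    K≥0 = i≤j⊔i _ (+ 0)

    i≡j+[i-j] : ∀ i j → i ≡ j + (i - j)
    i≡j+[i-j] = solve-∀

    z≥0 : ∀ j → + 0 ≤ z j
    z≥0 j = +-mono-≤ (z′≥0 j) (*-preserves-0≤ K≥0 (chargeOn-nonNeg U j))

    z≥b : ∀ {w} → w ∈ U → b w ≤ (L· z) w
    z≥b {w} w∈U with w ≟ x
    ... | yes refl = begin
      b w                                  ≡⟨ i≡j+[i-j] (b w) ((L· z′) w) ⟩
      (L· z′) w + (b w - (L· z′) w)        ≤⟨ +-monoʳ-≤ ((L· z′) w) (i≤i⊔j _ (+ 0)) ⟩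
      (L· z′) w + K                        ≡⟨ cong (_+_ ((L· z′) w)) (*-identityʳ K) ⟨
      (L· z′) w + K * + 1                  ≤⟨ +-monoʳ-≤ ((L· z′) w) (*-monoˡ-≤-nonNeg K {{nonNegative K≥0}} (L·chargeOn-pos w∈U y∉U x~y)) ⟩
      (L· z′) w + K * (L· chargeOn U) w    ≡⟨ L·z w ⟨
      (L· z) w                             ∎
      where open ≤-Reasoning
    ... | no w≢x = begin
      b w                                  ≤⟨ z′≥b (x∈p∧x≢y⇒x∈p-y w∈U w≢x) ⟩
      (L· z′) w                            ≤⟨ i≤i+j ((L· z′) w) _ {{nonNegative (*-preserves-0≤ K≥0 (L·chargeOn-nonNeg w∈U))}} ⟩
      (L· z′) w + K * (L· chargeOn U) w    ≡⟨ L·z w ⟨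
      (L· z) w                             ∎
      where open ≤-Reasoning

  potential : ∀ b {p} U → p ∉ U → Acc _⊂_ U → Potential b U
  potential b U p∉U (acc rec) with nonempty? U
  ... | no U-empty = (λ _ → + 0) , (λ _ → ≤-refl) , λ {w} w∈U → contradiction (w , w∈U) U-empty
  ... | yes (v , v∈U) with Star-crossing (_∈? U) (connected v _) v∈U p∉U
  ...   | x , y , x∈U , y∉U , x~y =
    extend x∈U y∉U x~y (potential b (U ─ ⁅ x ⁆) (p∉U ∘ p─q⊆p U ⁅ x ⁆) (rec (x∈p⇒p-x⊂p x∈U)))

  potential-off : ∀ b p → Potential b (∁ ⁅ p ⁆)
  potential-off b p = potential b (∁ ⁅ p ⁆) (x∈p⇒x∉∁p (x∈⁅x⁆ p)) (⊂-wellFounded _)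

module Borrowing (G : WGraph) (D₀ : Divisor G) where
  open WGraph G
  open Laplacian G

  ⟦_⟧ : (Fin n → ℕ) → Fin n → ℤ
  ⟦ mm ⟧ j = + mm j

  Reached : State G → Set
  Reached (D , mm) = ∀ u → D u ≡ D₀ u + (L· ⟦ mm ⟧) u

  unit : Fin n → Fin n → ℤ
  unit v j = if ⌊ v ≟ j ⌋ then + 1 else + 0

  borrow≡+column : ∀ v D u → borrow G v D u ≡ D u + Lap G u v
  borrow≡+column v D u with u ≟ v
  ... | yes refl = refl
  ... | no _     = refl

  ⟦incr⟧ : ∀ v mm j → ⟦ incr G v mm ⟧ j ≡ ⟦ mm ⟧ j + unit v j
  ⟦incr⟧ v mm j with j ≟ v | v ≟ j
  ... | yes refl | yes _   = cong +_ (ℕP.+-comm 1 (mm v))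
  ... | yes refl | no v≢v  = contradiction refl v≢v
  ... | no j≢v   | yes refl = contradiction refl j≢v
  ... | no _     | no _    = sym (+-identityʳ _)

  L·unit : ∀ v u → (L· unit v) u ≡ Lap G u v
  L·unit v u = trans (sum-cong-≗ select) (sum-select (Lap G u) v)
    where
    select : ∀ j → Lap G u j * unit v j ≡ (if ⌊ v ≟ j ⌋ then Lap G u j else + 0)
    select j with v ≟ j
    ... | yes _ = *-identityʳ (Lap G u j)
    ... | no _  = *-zeroʳ (Lap G u j)

  Reached-init : Reached (initState G D₀)
  Reached-init u = sym (trans (cong (_+_ (D₀ u)) L·0≡0) (+-identityʳ (D₀ u)))
    where
    L·0≡0 : (L· ⟦ (λ _ → 0) ⟧) u ≡ + 0
    L·0≡0 = trans (sum-cong-≗ (λ j → *-zeroʳ (Lap G u j))) (sum-replicate-zero n)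

  Next-Reached : ∀ {s′ s} → Next G s′ s → Reached s → Reached s′
  Next-Reached (step {D} {mm} v _ _ _) reached u = begin
    borrow G v D u                                   ≡⟨ borrow≡+column v D u ⟩
    D u + Lap G u v                                  ≡⟨ cong (_+ Lap G u v) (reached u) ⟩
    D₀ u + (L· ⟦ mm ⟧) u + Lap G u v                 ≡⟨ +-assoc (D₀ u) _ _ ⟩
    D₀ u + ((L· ⟦ mm ⟧) u + Lap G u v)               ≡⟨ cong (λ x → D₀ u + ((L· ⟦ mm ⟧) u + x)) (L·unit v u) ⟨
    D₀ u + ((L· ⟦ mm ⟧) u + (L· unit v) u)           ≡⟨ cong (_+_ (D₀ u)) (L·-distrib-+ ⟦ mm ⟧ (unit v) u) ⟨
    D₀ u + (L· (λ j → ⟦ mm ⟧ j + unit v j)) u        ≡⟨ cong (_+_ (D₀ u)) (L·-cong (⟦incr⟧ v mm) u) ⟨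
    D₀ u + (L· ⟦ incr G v mm ⟧) u                    ∎
    where open ≡-Reasoning

  Reached⇒Winnable : ∀ {D mm} → Reached (D , mm) → Effective G D → Winnable G D₀
  Reached⇒Winnable {D} {mm} reached D≥0 = (λ j → - ⟦ mm ⟧ j) , λ u → subst (+ 0 ≤_) (script u) (D≥0 u)
    where
    script : ∀ u → D u ≡ applyScript G (λ j → - ⟦ mm ⟧ j) D₀ u
    script u = begin
      D u                                              ≡⟨ reached u ⟩
      D₀ u + (L· ⟦ mm ⟧) u                             ≡⟨ cong (_+_ (D₀ u)) (neg-involutive _) ⟨
      D₀ u - - (L· ⟦ mm ⟧) u                           ≡⟨ cong (_-_ (D₀ u)) (L·-neg ⟦ mm ⟧ u) ⟨
      D₀ u - (L· (λ j → - ⟦ mm ⟧ j)) u                 ≡⟨ cong (_-_ (D₀ u)) (Σℤ≡sum (λ j → Lap G u j * - ⟦ mm ⟧ j)) ⟨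
      applyScript G (λ j → - ⟦ mm ⟧ j) D₀ u            ∎
      where open ≡-Reasoning

  Run-true⇒Winnable : ∀ {s} → Run G s true → Reached s → Winnable G D₀
  Run-true⇒Winnable (retTrue D≥0)       reached = Reached⇒Winnable reached D≥0
  Run-true⇒Winnable (continue next run) reached = Run-true⇒Winnable run (Next-Reached next reached)

  debt⇒below : ∀ {D mm ρ v} → Reached (D , mm) → ⟦ mm ⟧ ≤̇ ρ → + 0 ≤ D₀ v + (L· ρ) v → D v < + 0 →
               ⟦ mm ⟧ v < ρ v
  debt⇒below {D} {mm} {ρ} {v} reached mm≤ρ solvent debt with ⟦ mm ⟧ v <? ρ v
  ... | yes mm<ρ = mm<ρ
  ... | no mm≮ρ = contradiction debt (≤⇒≯ (begin
    + 0                     ≤⟨ solvent ⟩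
    D₀ v + (L· ρ) v         ≤⟨ +-monoʳ-≤ (D₀ v) (L·-antitone-at v mm≤ρ (≤-antisym (mm≤ρ v) (≮⇒≥ mm≮ρ))) ⟩
    D₀ v + (L· ⟦ mm ⟧) v    ≡⟨ reached v ⟨
    D v                     ∎))
    where open ≤-Reasoning

  incr-≤̇ : ∀ {mm ρ} v → ⟦ mm ⟧ ≤̇ ρ → ⟦ mm ⟧ v < ρ v → ⟦ incr G v mm ⟧ ≤̇ ρ
  incr-≤̇ v mm≤ρ below j with j ≟ v
  ... | yes refl = i<j⇒suc[i]≤j below
  ... | no _     = mm≤ρ j

  bounded⇒¬Run-false : ∀ {τ q s} → (∀ v → + 0 ≤ D₀ v + (L· τ) v) → τ q < c q →
                       Run G s false → Reached s → ⟦ proj₂ s ⟧ ≤̇ τ → ⊥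
  bounded⇒¬Run-false _ τq<cq (retFalse _ exhausted) _ mm≤τ = <⇒≱ τq<cq (≤-trans (+≤+ (exhausted _)) (mm≤τ _))
  bounded⇒¬Run-false solvent τq<cq (continue next@(step v _ _ debt) run) reached mm≤τ =
    bounded⇒¬Run-false solvent τq<cq run (Next-Reached next reached)
      (incr-≤̇ v mm≤τ (debt⇒below reached mm≤τ (solvent v) debt))

  Winnable⇒reduced-script : Winnable G D₀ → Fin n →
    ∃ λ τ → (∀ v → + 0 ≤ D₀ v + (L· τ) v) × (∀ v → + 0 ≤ τ v) × ∃ λ q → τ q < c q
  Winnable⇒reduced-script (σ , σ-wins) q₀ =
    let t , τ≥0 , q , τq<cq = reduce-by-multiple (λ j → - σ j) (charge G) (ℕ.>-nonZero ∘ charge-pos) q₀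
    in (λ j → - σ j - t * c j) , solvent t , τ≥0 , q , τq<cq
    where
    solvent : ∀ t v → + 0 ≤ D₀ v + (L· (λ j → - σ j - t * c j)) v
    solvent t v = begin
      + 0                                       ≤⟨ σ-wins v ⟩
      applyScript G σ D₀ v                      ≡⟨ cong (_-_ (D₀ v)) (Σℤ≡sum (λ j → Lap G v j * σ j)) ⟩
      D₀ v - (L· σ) v                           ≡⟨ cong (_+_ (D₀ v)) (L·-neg σ v) ⟨
      D₀ v + (L· (λ j → - σ j)) v               ≡⟨ cong (_+_ (D₀ v)) (L·-shift (λ j → - σ j) t v) ⟨
      D₀ v + (L· (λ j → - σ j - t * c j)) v     ∎
      where open ≤-Reasoning

  Run-false⇒¬Effective : ∀ {D mm} → Run G (D , mm) false → ¬ Effective G D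
  Run-false⇒¬Effective (retFalse ¬D≥0 _)             = ¬D≥0
  Run-false⇒¬Effective (continue (step _ ¬D≥0 _ _) _) = ¬D≥0

  Winnable⇒¬Run-false : Winnable G D₀ → Run G (initState G D₀) false → ⊥
  Winnable⇒¬Run-false winnable run =
    let τ , solvent , τ≥0 , q , τq<cq = Winnable⇒reduced-script winnable q₀
    in bounded⇒¬Run-false solvent τq<cq run Reached-init τ≥0
    where
    q₀ : Fin n
    q₀ = proj₁ (¬∀⟶∃¬ n _ (λ v → + 0 ≤? D₀ v) (Run-false⇒¬Effective run))

  module Termination (connected : Connected G) where
    open Potentials G connected

    z : Fin n → Fin n → ℤ
    z p = proj₁ (potential-off (λ w → - D₀ w) p)

    z≥0 : ∀ p j → + 0 ≤ z p j
    z≥0 p = proj₁ (proj₂ (potential-off (λ w → - D₀ w) p))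

    L·z≥-D₀ : ∀ p {w} → w ≢ p → - D₀ w ≤ (L· z p) w
    L·z≥-D₀ p w≢p = proj₂ (proj₂ (potential-off (λ w → - D₀ w) p)) (x∉p⇒x∈∁p (x≢y⇒x∉⁅y⁆ w≢p))

    ρ : Fin n → Fin n → ℤ
    ρ p j = z p j + c j

    ρ-nonNeg : ∀ p j → + 0 ≤ ρ p j
    ρ-nonNeg p j = +-mono-≤ (z≥0 p j) (+≤+ z≤n)

    charge≤ρ : ∀ p → c p ≤ ρ p p
    charge≤ρ p = i≤j⇒i≤k+j (z p p) {{nonNegative (z≥0 p p)}} ≤-refl

    ρ-solvent : ∀ p {w} → w ≢ p → + 0 ≤ D₀ w + (L· ρ p) w
    ρ-solvent p {w} w≢p = begin
      + 0                              ≡⟨ +-inverseʳ (D₀ w) ⟨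
      D₀ w - D₀ w                      ≤⟨ +-monoʳ-≤ (D₀ w) (L·z≥-D₀ p w≢p) ⟩
      D₀ w + (L· z p) w                ≡⟨ cong (_+_ (D₀ w)) (+-identityʳ _) ⟨
      D₀ w + ((L· z p) w + + 0)        ≡⟨ cong (λ x → D₀ w + ((L· z p) w + x)) (L·charge≡0 w) ⟨
      D₀ w + ((L· z p) w + (L· c) w)   ≡⟨ cong (_+_ (D₀ w)) (L·-distrib-+ (z p) c w) ⟨
      D₀ w + (L· ρ p) w                ∎
      where open ≤-Reasoning

    Bounded : (Fin n → ℕ) → Set
    Bounded mm = ∀ p → mm p ℕ.< charge G p → ⟦ mm ⟧ ≤̇ ρ p

    Invariant : State G → Set
    Invariant (D , mm) = Reached (D , mm) × Bounded mm

    Next-Bounded : ∀ {D mm s′} → Next G s′ (D , mm) → Reached (D , mm) → Bounded mm → Bounded (proj₂ s′)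
    Next-Bounded {D} {mm} (step v _ _ debt) reached bounded p incr<c = incr-≤̇ v mm≤ρ (below (v ≟ p))
      where
      incr-≥ : ∀ u → mm u ℕ.≤ incr G v mm u
      incr-≥ u with u ≟ v
      ... | yes _ = ℕP.n≤1+n _
      ... | no _  = ℕP.≤-refl
      mm<c : mm p ℕ.< charge G p
      mm<c = ℕP.≤-<-trans (incr-≥ p) incr<c
      mm≤ρ : ⟦ mm ⟧ ≤̇ ρ p
      mm≤ρ = bounded p mm<c
      below : Dec (v ≡ p) → ⟦ mm ⟧ v < ρ p v
      below (yes refl) = <-≤-trans (+<+ mm<c) (charge≤ρ v)
      below (no v≢p)   = debt⇒below reached mm≤ρ (ρ-solvent p v≢p) debt

    μ : State G → ℤ
    μ (_ , mm) = sum ⟦ mm ⟧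

    μ-bound : ℤ
    μ-bound = sum (λ p → sum (ρ p)) + + 1

    sum-incr : ∀ v mm → sum ⟦ incr G v mm ⟧ ≡ sum ⟦ mm ⟧ + + 1
    sum-incr v mm = begin
      sum ⟦ incr G v mm ⟧                ≡⟨ sum-cong-≗ (⟦incr⟧ v mm) ⟩
      sum (λ j → ⟦ mm ⟧ j + unit v j)    ≡⟨ ∑-distrib-+ ⟦ mm ⟧ (unit v) ⟩
      sum ⟦ mm ⟧ + sum (unit v)          ≡⟨ cong (_+_ (sum ⟦ mm ⟧)) (sum-select (λ _ → + 1) v) ⟩
      sum ⟦ mm ⟧ + + 1                   ∎
      where open ≡-Reasoning

    Next-Invariant : ∀ {s s′} → Next G s′ s → Invariant s → Invariant s′ × μ s < μ s′ × μ s′ ≤ μ-bound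
    Next-Invariant next@(step {D} {mm} v _ (p , mmp<c) _) (reached , bounded) =
      (Next-Reached next reached , Next-Bounded next reached bounded) , μ< , μ≤
      where
      μ< : sum ⟦ mm ⟧ < sum ⟦ incr G v mm ⟧
      μ< = subst (sum ⟦ mm ⟧ <_) (sym (sum-incr v mm)) (suc[i]≤j⇒i<j (≤-reflexive (+-comm (+ 1) (sum ⟦ mm ⟧))))
      μ≤ : sum ⟦ incr G v mm ⟧ ≤ μ-bound
      μ≤ = begin
        sum ⟦ incr G v mm ⟧                ≡⟨ sum-incr v mm ⟩
        sum ⟦ mm ⟧ + + 1                   ≤⟨ +-monoˡ-≤ (+ 1) (sum-mono-≤ (bounded p mmp<c)) ⟩
        sum (ρ p) + + 1                    ≤⟨ +-monoˡ-≤ (+ 1) (term≤sum (λ p′ → sum-nonNeg (ρ-nonNeg p′)) p) ⟩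
        μ-bound                            ∎
        where open ≤-Reasoning

    terminates : Acc (Next G) (initState G D₀)
    terminates = bounded-increase⇒Acc Invariant μ μ-bound Next-Invariant (Reached-init , λ p _ → ρ-nonNeg p)

Acc⇒Run : ∀ {G s} → Acc (Next G) s → ∃ λ r → Run G s r
Acc⇒Run {G} {D , mm} (acc rec) with all? (λ v → + 0 ≤? D v)
... | yes D≥0 = true , retTrue D≥0
... | no ¬D≥0 with all? (λ v → charge G v ℕ.≤? mm v)
...   | yes exhausted = false , retFalse ¬D≥0 exhausted
...   | no ¬exhausted =
  let p , p-open = ¬∀⟶∃¬ _ _ (λ v → charge G v ℕ.≤? mm v) ¬exhausted
      v , v-debt = ¬∀⟶∃¬ _ _ (λ v → + 0 ≤? D v) ¬D≥0
      next = step v ¬D≥0 (p , ℕP.≰⇒> p-open) (≰⇒> v-debt)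
      r , run = Acc⇒Run (rec next)
  in r , continue next run

mainTheorem5 : (G : WGraph) → Connected G → (D : Divisor G) →
    Acc (Next G) (initState G D)
    × (∃ λ (r : Bool) → Run G (initState G D) r)
    × (∀ (r : Bool) → Run G (initState G D) r → (r ≡ true ⇔ Winnable G D))
mainTheorem5 G connected D₀ = terminates , Acc⇒Run terminates , λ r run → mk⇔ (true⇒Winnable run) (Winnable⇒true run)
  where
  open Borrowing G D₀
  open Termination connected

  true⇒Winnable : ∀ {r} → Run G (initState G D₀) r → r ≡ true → Winnable G D₀
  true⇒Winnable run refl = Run-true⇒Winnable run Reached-init

  Winnable⇒true : ∀ {r} → Run G (initState G D₀) r → Winnable G D₀ → r ≡ true
  Winnable⇒true {true}  _   _        = refl
  Winnable⇒true {false} run winnable = contradiction run (Winnable⇒¬Run-false winnable)
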